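{- Let $d\in\mathbb{N}$ and let $G$ be a finite graph with vertices $v_0,v_1$ whose distance in $G$ is at most $d/2$ and at least three. Let $C=C_d(v_0,v_1,G)$. If $x$ and $y$ are vertices of $Ex_d(v_0,v_1)$ adjacent to $v_0$ or $v_1$ (i.e. neighbours of $\{v_0,v_1\}$ in $Ex_d(v_0,v_1)$) that lie in the same component of $Ex_d(v_0,v_1)-v_0-v_1$, then the vertices $x'$ and $y'$ of $G$ lie in the same component of $C$.
   Context: All graphs are finite, without loops or parallel edges. For a vertex $v$ and $d\in\mathbb{N}$, the ball $D_d(v)$ is the subgraph of $G$ consisting of all vertices and edges of $G$ lying on some closed walk of length at most $d$ containing $v$. For vertices $v,w$ of distance at most $d/2$, the explorer neighbourhood $Ex_d(v,w)$ is defined as follows. The core is the set of all vertices on shortest $v$–$w$ paths in $G$. Take a copy of $D_d(v)$ in which each vertex $u$ is labelled with the set of shortest paths from the core to $u$ contained in $D_d(v)$, and a copy of $D_d(w)$ in which each vertex $u$ is labelled with the set of shortest paths from the core to $u$ contained in $D_d(w)$. $Ex_d(v,w)$ is the union of these two labelled balls, where two vertices (copies of the same vertex of $G$) are identified if their label sets share an element. For a vertex $x$ of $Ex_d(v,w)$, $x'$ denotes the unique vertex of $G$ of which $x$ is a copy. Core vertices (in particular $v,w$) have unique copies, denoted by the same letters. For $X\subseteq V(G)$, $N(X)$ is the set of vertices outside $X$ with a neighbour in $X$. The connectivity graph $C_d(v_0,v_1,G)$ has vertex set $N(\{v_0,v_1\})$, and $xy$ is an edge if there is an $x$–$y$ path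 in $D_d(v_i)-v_0-v_1$ for some $i\in\{0,1\}$. -}

module Defs where

open import Data.Nat using (ℕ; zero; suc; _≤_; _*_)
open import Data.Fin using (Fin; zero; suc)
open import Data.Bool using (Bool; true; false; T)
open import Data.Empty using (⊥)
open import Data.Product using (Σ; _×_; _,_; proj₁; proj₂)
open import Data.Sum using (_⊎_)
open import Relation.Binary.PropositionalEquality using (_≡_; _≢_)

record Graph : Set where
  field
    size       : ℕ
    adj        : Fin size → Fin size → Bool
    adj-sym    : ∀ u v → adj u v ≡ adj v u
    adj-irrefl : ∀ u → adj u u ≡ false

module _ (G : Graph) where
  open Graph G

  V : Set
  V = Fin size

  Adj : V → V → Set
  Adj u v = T (adj u v)

  data Walk : V → V → Set where
    [_]  : (v : V) → Walk v v
    cons : (u : V) {v w : V} → Adj u v → Walk v w → Walk u w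

  len : {a b : V} → Walk a b → ℕ
  len [ v ]         = zero
  len (cons u _ W) = suc (len W)

  _∈W_ : {a b : V} → V → Walk a b → Set
  x ∈W [ v ]        = x ≡ v
  x ∈W cons u _ W  = x ≡ u ⊎ x ∈W W

  EdgeW : {a b : V} → V → V → Walk a b → Set
  EdgeW x y [ v ]            = ⊥
  EdgeW x y (cons u {v} _ W) = ((x ≡ u × y ≡ v) ⊎ (x ≡ v × y ≡ u)) ⊎ EdgeW x y W

  WalkIn : (V → Set) → (V → V → Set) → {a b : V} → Walk a b → Set
  WalkIn P Q [ v ]            = P v
  WalkIn P Q (cons u {v} _ W) = P u × Q u v × WalkIn P Q W

  -- vertices / edges of the ball D_d(v): lying on a closed walk of
  -- length at most d containing v
  InBall : ℕ → V → V → Set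
  InBall d v x = Σ V λ u → Σ (Walk u u) λ W → len W ≤ d × v ∈W W × x ∈W W

  EdgeInBall : ℕ → V → V → V → Set
  EdgeInBall d v x y = Σ V λ u → Σ (Walk u u) λ W → len W ≤ d × v ∈W W × EdgeW x y W

  Shortest : {a b : V} → Walk a b → Set
  Shortest {a} {b} W = (W' : Walk a b) → len W ≤ len W'

  Dist : V → V → ℕ → Set
  Dist a b k = Σ (Walk a b) λ W → Shortest W × len W ≡ k

  Core : V → V → V → Set
  Core v₀ v₁ c = Σ (Walk v₀ v₁) λ W → Shortest W × c ∈W W

  CoreShortest : V → V → {c u : V} → Walk c u → Set
  CoreShortest v₀ v₁ {c} {u} P =
    Core v₀ v₁ c × ((c' : V) → Core v₀ v₁ c' → (W : Walk c' u) → len P ≤ len W)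

  pick : V → V → Fin 2 → V
  pick v₀ v₁ zero    = v₀
  pick v₀ v₁ (suc _) = v₁

  module _ (d : ℕ) (v₀ v₁ : V) where

    -- P belongs to the label set (in the copy of D_d(v_i)) of its endpoint:
    -- a shortest core path contained in D_d(v_i)
    Label : Fin 2 → {c u : V} → Walk c u → Set
    Label i P = CoreShortest v₀ v₁ P
              × WalkIn (InBall d (pick v₀ v₁ i)) (EdgeInBall d (pick v₀ v₁ i)) P

    -- representatives of vertices of Ex_d(v₀,v₁): (i , u , _) is the copy
    -- of u in the copy of D_d(v_i)
    ExV : Set
    ExV = Σ (Fin 2) λ i → Σ V λ u → InBall d (pick v₀ v₁ i) u

    side : ExV → Fin 2
    side = proj₁

    -- x' : the vertex of G of which x is a copy
    orig : ExV → V
    orig x = proj₁ (proj₂ x)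

    -- identification of copies: same copy, or copies of the same vertex
    -- whose label sets share an element
    data _≈_ : ExV → ExV → Set where
      same : (i : Fin 2) (u : V) (p q : InBall d (pick v₀ v₁ i) u)
           → (i , u , p) ≈ (i , u , q)
      glue : (i j : Fin 2) (u : V) (p : InBall d (pick v₀ v₁ i) u)
             (q : InBall d (pick v₀ v₁ j) u) (c : V) (P : Walk c u)
           → Label i P → Label j P → (i , u , p) ≈ (j , u , q)

    -- adjacency in Ex_d(v₀,v₁) (the union of the two identified balls)
    data ExAdj : ExV → ExV → Set where
      exEdge : {a b : ExV} (i : Fin 2) (u w : V)
               (pu : InBall d (pick v₀ v₁ i) u) (pw : InBall d (pick v₀ v₁ i) w)
             → a ≈ (i , u , pu) → b ≈ (i , w , pw)
             → EdgeInBall d (pick v₀ v₁ i) u w → ExAdj a b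

    Avoids : V → Set
    Avoids u = u ≢ v₀ × u ≢ v₁

    ExNbr : ExV → Set
    ExNbr x = Avoids (orig x)
            × Σ (Fin 2) λ i → Σ ExV λ b → orig b ≡ pick v₀ v₁ i × ExAdj x b

    data Chain {A : Set} (P : A → Set) (R : A → A → Set) : A → A → Set where
      done : {a : A} → P a → Chain P R a a
      step : {a b c : A} → P a → R a b → Chain P R b c → Chain P R a c

    -- same component of Ex_d(v₀,v₁) - v₀ - v₁
    ExComp : ExV → ExV → Set
    ExComp = Chain (λ x → Avoids (orig x)) (λ x y → ExAdj x y ⊎ x ≈ y)

    CVert : V → Set
    CVert z = Avoids z × (Adj z v₀ ⊎ Adj z v₁)

    CEdge : V → V → Set
    CEdge x y = Σ (Fin 2) λ i → Σ (Walk x y) λ W →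
      WalkIn (λ u → InBall d (pick v₀ v₁ i) u × Avoids u)
             (EdgeInBall d (pick v₀ v₁ i)) W

    CComp : V → V → Set
    CComp = Chain CVert CEdge

-- Follow a path of Ex_d(v₀,v₁) - v₀ - v₁ from x to y while keeping the invariant that the
-- current vertex z is reached, by a walk inside the ball of z avoiding v₀ and v₁, from some
-- vertex of the component of x' in C.  Ball edges preserve this at once.  Crossing an
-- identification of the copies of u in D_d(v_i) and D_d(v_j) through a common label P uses
-- a walk T from a neighbour n of {v₀,v₁} to u that avoids v₀, v₁ and lies in both balls:
-- T is P minus its first vertex if P starts at v₀ or v₁, and otherwise P preceded by the
-- segment of a shortest v₀–v₁ path from the neighbour of v₀ to the start of P.  That segment
-- lies in both balls because 2 dist(v₀,v₁) ≤ d.  Walking back along T in D_d(v_i) is a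
-- C-edge to n, and walking forward along T in D_d(v_j) re-establishes the invariant.
module Submission where

open import Defs
open import Data.Nat using (ℕ; suc; _+_; _*_; _≤_; _<_; z≤n; s≤s)
open import Data.Nat.Properties
  using (≤-refl; ≤-trans; m≤n⇒m≤1+n; 1+n≰n; +-comm; +-identityʳ; *-monoʳ-≤)
open import Data.Fin using (Fin; zero; suc; _≟_)
open import Data.Bool using (T)
open import Data.Empty using (⊥-elim)
open import Data.Product using (Σ; _×_; _,_; proj₁; proj₂)
open import Data.Sum using (_⊎_; inj₁; inj₂)
open import Function using (_∘_)
open import Relation.Binary.PropositionalEquality
  using (_≡_; _≢_; refl; sym; trans; cong; subst; subst₂; module ≡-Reasoning)
open import Relation.Nullary using (¬_; yes; no)

module WalkProperties (G : Graph) where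
  open Graph G

  private
    variable
      a b c u v x y z : V G

  infix 4 _∈_
  _∈_ : V G → Walk G a b → Set
  _∈_ = _∈W_ G

  Adj-sym : Adj G u v → Adj G v u
  Adj-sym {u} {v} = subst T (adj-sym u v)

  infixr 5 _++_
  _++_ : Walk G a b → Walk G b c → Walk G a c
  [ _ ]       ++ W₂ = W₂
  cons u h W₁ ++ W₂ = cons u h (W₁ ++ W₂)

  reverse : Walk G a b → Walk G b a
  reverse [ v ]            = [ v ]
  reverse (cons u {v} h W) = reverse W ++ cons v (Adj-sym h) [ u ]

  len-++ : (W₁ : Walk G a b) (W₂ : Walk G b c) → len G (W₁ ++ W₂) ≡ len G W₁ + len G W₂
  len-++ [ _ ]         W₂ = refl
  len-++ (cons u h W₁) W₂ = cong suc (len-++ W₁ W₂)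

  len-reverse : (W : Walk G a b) → len G (reverse W) ≡ len G W
  len-reverse [ v ]            = refl
  len-reverse (cons u {v} h W) = begin
    len G (reverse W ++ cons v (Adj-sym h) [ u ]) ≡⟨ len-++ (reverse W) _ ⟩
    len G (reverse W) + 1                         ≡⟨ +-comm (len G (reverse W)) 1 ⟩
    suc (len G (reverse W))                       ≡⟨ cong suc (len-reverse W) ⟩
    suc (len G W)                                 ∎
    where open ≡-Reasoning

  len-++-reverse : (W : Walk G a b) → len G (W ++ reverse W) ≡ 2 * len G W
  len-++-reverse W = begin
    len G (W ++ reverse W)       ≡⟨ len-++ W (reverse W) ⟩
    len G W + len G (reverse W)  ≡⟨ cong (len G W +_) (len-reverse W) ⟩
    len G W + len G W            ≡⟨ cong (len G W +_) (sym (+-identityʳ (len G W))) ⟩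
    2 * len G W                  ∎
    where open ≡-Reasoning

  len<len-++-nonempty : (W₁ : Walk G a b) (W₂ : Walk G b c) → b ≢ c → len G W₁ < len G (W₁ ++ W₂)
  len<len-++-nonempty [ _ ]         [ _ ]          b≢c = ⊥-elim (b≢c refl)
  len<len-++-nonempty [ _ ]         (cons _ _ _)   _   = s≤s z≤n
  len<len-++-nonempty (cons u h W₁) W₂             b≢c = s≤s (len<len-++-nonempty W₁ W₂ b≢c)

  start-∈ : (W : Walk G a b) → a ∈ W
  start-∈ [ v ]        = refl
  start-∈ (cons u h W) = inj₁ refl

  end-∈ : (W : Walk G a b) → b ∈ W
  end-∈ [ v ]        = refl
  end-∈ (cons u h W) = inj₂ (end-∈ W)

  ∈-++ˡ : (W₁ : Walk G a b) {W₂ : Walk G b c} → z ∈ W₁ → z ∈ W₁ ++ W₂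
  ∈-++ˡ [ _ ]         {W₂} refl       = start-∈ W₂
  ∈-++ˡ (cons u h W₁)      (inj₁ z≡u) = inj₁ z≡u
  ∈-++ˡ (cons u h W₁)      (inj₂ z∈W) = inj₂ (∈-++ˡ W₁ z∈W)

  ∈-split : (W : Walk G a b) → z ∈ W → Σ (Walk G a z) λ W₁ → Σ (Walk G z b) λ W₂ → W₁ ++ W₂ ≡ W
  ∈-split [ v ]        refl       = [ v ] , [ v ] , refl
  ∈-split (cons u h W) (inj₁ refl) = [ u ] , cons u h W , refl
  ∈-split (cons u h W) (inj₂ z∈W) with ∈-split W z∈W
  ... | W₁ , W₂ , refl = cons u h W₁ , W₂ , refl

  prefix : (W : Walk G a b) → z ∈ W → Σ (Walk G a z) λ W' → len G W' ≤ len G W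
  prefix [ v ]        refl        = [ v ] , ≤-refl
  prefix (cons u h W) (inj₁ refl) = [ u ] , z≤n
  prefix (cons u h W) (inj₂ z∈W) with prefix W z∈W
  ... | W' , W'≤W = cons u h W' , s≤s W'≤W

  suffix : (W : Walk G a b) → z ∈ W → Σ (Walk G z b) λ W' → len G W' ≤ len G W
  suffix [ v ]        refl        = [ v ] , ≤-refl
  suffix (cons u h W) (inj₁ refl) = cons u h W , ≤-refl
  suffix (cons u h W) (inj₂ z∈W) with suffix W z∈W
  ... | W' , W'≤W = W' , m≤n⇒m≤1+n W'≤W

  EdgeW-sym : (W : Walk G a b) → EdgeW G x y W → EdgeW G y x W
  EdgeW-sym (cons u h W) (inj₁ (inj₁ (x≡u , y≡v))) = inj₁ (inj₂ (y≡v , x≡u))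
  EdgeW-sym (cons u h W) (inj₁ (inj₂ (x≡v , y≡u))) = inj₁ (inj₁ (y≡u , x≡v))
  EdgeW-sym (cons u h W) (inj₂ e)                  = inj₂ (EdgeW-sym W e)

  EdgeW⇒Adj : (W : Walk G a b) → EdgeW G x y W → Adj G x y
  EdgeW⇒Adj (cons u h W) (inj₁ (inj₁ (refl , refl))) = h
  EdgeW⇒Adj (cons u h W) (inj₁ (inj₂ (refl , refl))) = Adj-sym h
  EdgeW⇒Adj (cons u h W) (inj₂ e)                     = EdgeW⇒Adj W e

  module _ {P : V G → Set} {Q : V G → V G → Set} where

    WalkIn-start : (W : Walk G a b) → WalkIn G P Q W → P a
    WalkIn-start [ v ]        p       = p
    WalkIn-start (cons u h W) (p , _) = p

    WalkIn-tail : (h : Adj G a b) (W : Walk G b c) → WalkIn G P Q (cons a h W) → WalkIn G P Q W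
    WalkIn-tail h W (_ , _ , w) = w

    WalkIn-++ : (W₁ : Walk G a b) {W₂ : Walk G b c}
              → WalkIn G P Q W₁ → WalkIn G P Q W₂ → WalkIn G P Q (W₁ ++ W₂)
    WalkIn-++ [ _ ]         _            w₂ = w₂
    WalkIn-++ (cons u h W₁) (p , q , w₁) w₂ = p , q , WalkIn-++ W₁ w₁ w₂

    WalkIn-++⁻ˡ : (W₁ : Walk G a b) {W₂ : Walk G b c} → WalkIn G P Q (W₁ ++ W₂) → WalkIn G P Q W₁
    WalkIn-++⁻ˡ [ _ ]         {W₂} w           = WalkIn-start W₂ w
    WalkIn-++⁻ˡ (cons u h W₁)      (p , q , w) = p , q , WalkIn-++⁻ˡ W₁ w

    WalkIn-reverse : (∀ {x y} → Q x y → Q y x) → (W : Walk G a b) → WalkIn G P Q W → WalkIn G P Q (reverse W)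
    WalkIn-reverse Q-sym [ v ]        p           = p
    WalkIn-reverse Q-sym (cons u h W) (p , q , w) =
      WalkIn-++ (reverse W) (WalkIn-reverse Q-sym W w) (WalkIn-start W w , Q-sym q , p)

    WalkIn-∩ : {P' : V G → Set} (W : Walk G a b)
             → WalkIn G P Q W → (∀ {z} → z ∈ W → P' z) → WalkIn G (λ z → P z × P' z) Q W
    WalkIn-∩ [ v ]        p           p' = p , p' refl
    WalkIn-∩ (cons u h W) (p , q , w) p' = (p , p' (inj₁ refl)) , q , WalkIn-∩ W w (p' ∘ inj₂)

    WalkIn-intro : (W : Walk G a b)
                 → (∀ {z} → z ∈ W → P z) → (∀ {x y} → EdgeW G x y W → Q x y) → WalkIn G P Q W
    WalkIn-intro [ v ]        p q = p refl
    WalkIn-intro (cons u h W) p q =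
      p (inj₁ refl) , q (inj₁ (inj₁ (refl , refl))) , WalkIn-intro W (p ∘ inj₂) (q ∘ inj₂)

  shortest⇒start∉tail : (h : Adj G a b) (W : Walk G b c) → Shortest G (cons a h W) → ¬ a ∈ W
  shortest⇒start∉tail h W shortest a∈W with suffix W a∈W
  ... | W' , W'≤W = 1+n≰n (≤-trans (shortest W') W'≤W)

  shortest⇒end∉init : (W₁ : Walk G a b) (W₂ : Walk G b c) → b ≢ c → Shortest G (W₁ ++ W₂) → ¬ c ∈ W₁
  shortest⇒end∉init W₁ W₂ b≢c shortest c∈W₁ with prefix W₁ c∈W₁
  ... | W' , W'≤W₁ =
    1+n≰n (≤-trans (len<len-++-nonempty W₁ W₂ b≢c) (≤-trans (shortest W') W'≤W₁))

  coreShortest⇒core∉tail : ∀ {v₀ v₁} (h : Adj G a b) (P : Walk G b c)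
                         → CoreShortest G v₀ v₁ (cons a h P) → Core G v₀ v₁ z → ¬ z ∈ P
  coreShortest⇒core∉tail h P (_ , minimal) z-core z∈P with suffix P z∈P
  ... | P' , P'≤P = 1+n≰n (≤-trans (minimal _ z-core P') P'≤P)

  coreShortest⇒core∈⇒start : ∀ {v₀ v₁} (P : Walk G a b)
                           → CoreShortest G v₀ v₁ P → Core G v₀ v₁ z → z ∈ P → z ≡ a
  coreShortest⇒core∈⇒start [ v ]        _  _      z∈P         = z∈P
  coreShortest⇒core∈⇒start (cons u h P) _  _      (inj₁ z≡u)  = z≡u
  coreShortest⇒core∈⇒start (cons u h P) cs z-core (inj₂ z∈P) =
    ⊥-elim (coreShortest⇒core∉tail h P cs z-core z∈P)

  module _ (d : ℕ) where

    EdgeInBall-sym : EdgeInBall G d v x y → EdgeInBall G d v y x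
    EdgeInBall-sym (u , W , W≤d , v∈W , e) = u , W , W≤d , v∈W , EdgeW-sym W e

    EdgeInBall⇒Adj : EdgeInBall G d v x y → Adj G x y
    EdgeInBall⇒Adj (_ , W , _ , _ , e) = EdgeW⇒Adj W e

    closedWalk-in-ball : (W : Walk G u u) → len G W ≤ d → v ∈ W
                       → WalkIn G (InBall G d v) (EdgeInBall G d v) W
    closedWalk-in-ball W W≤d v∈W =
      WalkIn-intro W (λ z∈W → _ , W , W≤d , v∈W , z∈W) (λ e → _ , W , W≤d , v∈W , e)

    walk-in-ball : (W : Walk G a b) → 2 * len G W ≤ d → v ∈ W
                 → WalkIn G (InBall G d v) (EdgeInBall G d v) W
    walk-in-ball W 2W≤d v∈W = WalkIn-++⁻ˡ W
      (closedWalk-in-ball (W ++ reverse W) (subst (_≤ d) (sym (len-++-reverse W)) 2W≤d) (∈-++ˡ W v∈W))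

module Explorer (G : Graph) (d : ℕ) (v₀ v₁ : V G) {k : ℕ}
                (dist : Dist G v₀ v₁ k) (2k≤d : 2 * k ≤ d) where
  open WalkProperties G

  private
    variable
      a b c u : V G
      x y : ExV G d v₀ v₁

  Ball : Fin 2 → V G → Set
  Ball i = InBall G d (pick G v₀ v₁ i)

  EBall : Fin 2 → V G → V G → Set
  EBall i = EdgeInBall G d (pick G v₀ v₁ i)

  Av : V G → Set
  Av = Avoids G d v₀ v₁

  Inside : Fin 2 → Walk G a b → Set
  Inside i = WalkIn G (λ u → Ball i u × Av u) (EBall i)

  avoiding : {W : Walk G a b} → ¬ v₀ ∈ W → ¬ v₁ ∈ W → ∀ {z} → z ∈ W → Av z
  avoiding v₀∉W v₁∉W z∈W = (λ { refl → v₀∉W z∈W }) , (λ { refl → v₁∉W z∈W })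

  v₀-core : Core G v₀ v₁ v₀
  v₀-core = proj₁ dist , proj₁ (proj₂ dist) , start-∈ (proj₁ dist)

  v₁-core : Core G v₀ v₁ v₁
  v₁-core = proj₁ dist , proj₁ (proj₂ dist) , end-∈ (proj₁ dist)

  pick-∈ : (W : Walk G v₀ v₁) (i : Fin 2) → pick G v₀ v₁ i ∈ W
  pick-∈ W zero    = start-∈ W
  pick-∈ W (suc _) = end-∈ W

  shortest-in-ball : (Q : Walk G v₀ v₁) → Shortest G Q → (i : Fin 2) → WalkIn G (Ball i) (EBall i) Q
  shortest-in-ball Q shortest i = walk-in-ball d Q (≤-trans (*-monoʳ-≤ 2 Q≤k) 2k≤d) (pick-∈ Q i)
    where
    Q≤k : len G Q ≤ k
    Q≤k = subst (len G Q ≤_) (proj₂ (proj₂ dist)) (shortest (proj₁ dist))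

  NbrWalk : Walk G c u → Set
  NbrWalk {u = u} P = Σ (V G) λ n → CVert G d v₀ v₁ n × Σ (Walk G n u) λ T →
                      ∀ i → Label G d v₀ v₁ i P → Inside i T

  nbrWalk-from-end : (P : Walk G c u) → CoreShortest G v₀ v₁ P → c ≡ v₀ ⊎ c ≡ v₁ → Av u → NbrWalk P
  nbrWalk-from-end [ _ ] _ (inj₁ refl) (u≢v₀ , _) = ⊥-elim (u≢v₀ refl)
  nbrWalk-from-end [ _ ] _ (inj₂ refl) (_ , u≢v₁) = ⊥-elim (u≢v₁ refl)
  nbrWalk-from-end (cons c {n} h P) cs c-end _ =
    n , (P-avoids (start-∈ P) , n-nbr c-end) , P ,
    λ i label → WalkIn-∩ P (WalkIn-tail h P (proj₂ label)) P-avoids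
    where
    P-avoids : ∀ {z} → z ∈ P → Av z
    P-avoids = avoiding (coreShortest⇒core∉tail h P cs v₀-core) (coreShortest⇒core∉tail h P cs v₁-core)
    n-nbr : c ≡ v₀ ⊎ c ≡ v₁ → Adj G n v₀ ⊎ Adj G n v₁
    n-nbr (inj₁ refl) = inj₁ (Adj-sym h)
    n-nbr (inj₂ refl) = inj₂ (Adj-sym h)

  nbrWalk-from-interior : (P : Walk G c u) → CoreShortest G v₀ v₁ P → c ≢ v₀ → c ≢ v₁ → NbrWalk P
  nbrWalk-from-interior P cs c≢v₀ c≢v₁ with proj₁ cs
  ... | [ _ ] , _ , c≡v₀ = ⊥-elim (c≢v₀ c≡v₀)
  ... | cons _ h Q , _ , inj₁ c≡v₀ = ⊥-elim (c≢v₀ c≡v₀)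
  ... | cons _ {q} h Q , Q-shortest , inj₂ c∈Q with ∈-split Q c∈Q
  ...   | R , S , refl =
    q , (R-avoids (start-∈ R) , inj₁ (Adj-sym h)) , R ++ P ,
    λ i label → WalkIn-++ R (WalkIn-∩ R (R-in-ball i) R-avoids) (WalkIn-∩ P (proj₂ label) P-avoids)
    where
    R-avoids : ∀ {z} → z ∈ R → Av z
    R-avoids = avoiding (shortest⇒start∉tail h (R ++ S) Q-shortest ∘ ∈-++ˡ R {S})
                        (shortest⇒end∉init (cons v₀ h R) S c≢v₁ Q-shortest ∘ inj₂)
    R-in-ball : ∀ i → WalkIn G (Ball i) (EBall i) R
    R-in-ball i = WalkIn-++⁻ˡ R (WalkIn-tail h (R ++ S) (shortest-in-ball (cons v₀ h (R ++ S)) Q-shortest i))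
    P-avoids : ∀ {z} → z ∈ P → Av z
    P-avoids = avoiding (c≢v₀ ∘ sym ∘ coreShortest⇒core∈⇒start P cs v₀-core)
                        (c≢v₁ ∘ sym ∘ coreShortest⇒core∈⇒start P cs v₁-core)

  nbrWalk : (P : Walk G c u) → CoreShortest G v₀ v₁ P → Av u → NbrWalk P
  nbrWalk {c} P cs u-avoids with c ≟ v₀ | c ≟ v₁
  ... | yes c≡v₀ | _        = nbrWalk-from-end P cs (inj₁ c≡v₀) u-avoids
  ... | no _     | yes c≡v₁ = nbrWalk-from-end P cs (inj₂ c≡v₁) u-avoids
  ... | no c≢v₀  | no c≢v₁  = nbrWalk-from-interior P cs c≢v₀ c≢v₁

  ≈-orig : _≈_ G d v₀ v₁ x y → orig G d v₀ v₁ x ≡ orig G d v₀ v₁ y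
  ≈-orig (same _ _ _ _)           = refl
  ≈-orig (glue _ _ _ _ _ _ _ _ _) = refl

  ≈-sym : _≈_ G d v₀ v₁ x y → _≈_ G d v₀ v₁ y x
  ≈-sym (same i u p q)                   = same i u q p
  ≈-sym (glue i j u p q c P label label') = glue j i u q p c P label' label

  Chain-head : ∀ {A : Set} {P : A → Set} {R : A → A → Set} {a b : A}
             → Chain G d v₀ v₁ P R a b → P a
  Chain-head (done pa)     = pa
  Chain-head (step pa _ _) = pa

  Chain-snoc : ∀ {A : Set} {P : A → Set} {R : A → A → Set} {a b c : A}
             → Chain G d v₀ v₁ P R a b → R b c → P c → Chain G d v₀ v₁ P R a c
  Chain-snoc (done pa)        r pc = step pa r (done pc)
  Chain-snoc (step pa r' ch) r pc = step pa r' (Chain-snoc ch r pc)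

  Reached : V G → ExV G d v₀ v₁ → Set
  Reached x₀ z = Σ (V G) λ w → CComp G d v₀ v₁ x₀ w ×
                 Σ (Walk G w (orig G d v₀ v₁ z)) λ W → Inside (side G d v₀ v₁ z) W

  module _ {x₀ : V G} where

    Reached-≈ : _≈_ G d v₀ v₁ x y → Av (orig G d v₀ v₁ x) → Reached x₀ x → Reached x₀ y
    Reached-≈ (same _ _ _ _) _ reached = reached
    Reached-≈ (glue i j u _ _ _ P label-i label-j) u-avoids (w , w-conn , W , W-inside)
      with nbrWalk P (proj₁ label-i) u-avoids
    ... | n , n-nbr , T , T-inside =
      n , Chain-snoc w-conn (i , W ++ reverse T , back-to-n) n-nbr , T , T-inside j label-j
      where
      back-to-n : Inside i (W ++ reverse T)
      back-to-n = WalkIn-++ W W-inside (WalkIn-reverse (EdgeInBall-sym d) T (T-inside i label-i))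

    Reached-ExAdj : ExAdj G d v₀ v₁ x y → Av (orig G d v₀ v₁ x) → Av (orig G d v₀ v₁ y)
                  → Reached x₀ x → Reached x₀ y
    Reached-ExAdj (exEdge i u u' pu pu' x≈u y≈u' e) x-avoids y-avoids reached
      with Reached-≈ x≈u x-avoids reached
    ... | w , w-conn , W , W-inside =
      Reached-≈ (≈-sym y≈u') u'-avoids
        (w , w-conn , W ++ cons u (EdgeInBall⇒Adj d e) [ u' ] ,
         WalkIn-++ W W-inside ((pu , u-avoids) , e , (pu' , u'-avoids)))
      where
      u-avoids : Av u
      u-avoids = subst Av (≈-orig x≈u) x-avoids
      u'-avoids : Av u'
      u'-avoids = subst Av (≈-orig y≈u') y-avoids

    Reached-ExComp : ExComp G d v₀ v₁ x y → Reached x₀ x → Reached x₀ y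
    Reached-ExComp (done _)                        reached = reached
    Reached-ExComp (step x-avoids (inj₁ adj) path) reached =
      Reached-ExComp path (Reached-ExAdj adj x-avoids (Chain-head path) reached)
    Reached-ExComp (step x-avoids (inj₂ x≈y) path) reached =
      Reached-ExComp path (Reached-≈ x≈y x-avoids reached)

  ExNbr⇒CVert : ExNbr G d v₀ v₁ x → CVert G d v₀ v₁ (orig G d v₀ v₁ x)
  ExNbr⇒CVert (x-avoids , i , b , b≡vᵢ , exEdge _ _ _ _ _ x≈u b≈u' e) =
    x-avoids , pick-adj i (subst₂ (Adj G) (sym (≈-orig x≈u)) (trans (sym (≈-orig b≈u')) b≡vᵢ)
                                  (EdgeInBall⇒Adj d e))
    where
    pick-adj : ∀ {z} i → Adj G z (pick G v₀ v₁ i) → Adj G z v₀ ⊎ Adj G z v₁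
    pick-adj zero    adj = inj₁ adj
    pick-adj (suc _) adj = inj₂ adj

  Reached-self : ExNbr G d v₀ v₁ x → Reached (orig G d v₀ v₁ x) x
  Reached-self {x} x-nbr = _ , done (ExNbr⇒CVert x-nbr) , [ _ ] , proj₂ (proj₂ x) , proj₁ x-nbr

  ExComp⇒CComp : ExNbr G d v₀ v₁ x → ExNbr G d v₀ v₁ y → ExComp G d v₀ v₁ x y
               → CComp G d v₀ v₁ (orig G d v₀ v₁ x) (orig G d v₀ v₁ y)
  ExComp⇒CComp {y = y} x-nbr y-nbr path with Reached-ExComp path (Reached-self x-nbr)
  ... | w , w-conn , W , W-inside =
    Chain-snoc w-conn (side G d v₀ v₁ y , W , W-inside) (ExNbr⇒CVert y-nbr)

lemma3p6 : (G : Graph) (d : ℕ) (v₀ v₁ : V G) (k : ℕ)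
         → Dist G v₀ v₁ k → 3 ≤ k → 2 * k ≤ d
         → (x y : ExV G d v₀ v₁)
         → ExNbr G d v₀ v₁ x → ExNbr G d v₀ v₁ y
         → ExComp G d v₀ v₁ x y
         → CComp G d v₀ v₁ (orig G d v₀ v₁ x) (orig G d v₀ v₁ y)
lemma3p6 G d v₀ v₁ k dist _ 2k≤d x y = Explorer.ExComp⇒CComp G d v₀ v₁ dist 2k≤d
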